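{- Let $\alpha$ and $\beta$ be words such that $\alpha$, $\beta$ and the concatenation $\alpha\beta$ are reduced words (of some permutations). Then (i) every restricted shuffle of $\alpha$ with $\beta$ is a reduced word, and (ii) distinct restricted shuffles of $\alpha$ with $\beta$ give pairwise distinct words.
   Context: A word $i_1\ldots i_l$ (positive integers) represents $s_{i_1}\cdots s_{i_l}$ in a symmetric group, $s_i=(i,i+1)$, and is reduced if no shorter word represents the same permutation. Restricted shuffle: let $\alpha=\alpha_1\ldots\alpha_n$ have its letters colored red and $\beta=\beta_1\ldots\beta_m$ colored blue. A restricted shuffle of $\alpha$ with $\beta$ is a word $w=w_1\ldots w_{n+m}$ of $n$ red and $m$ blue letters such that (1) the red letters of $w$, read left to right, form $\alpha$ and the blue letters form $\beta$; (2) whenever a blue letter $\beta_k$ lies to the left of a red letter $\alpha_i$ in $w$, none of $\beta_k-1,\beta_k,\beta_k+1$ occurs among $\alpha_i,\alpha_{i+1},\ldots,\alpha_n$. $\mathrm{ResSh}(\alpha,\beta)$ is the set of all restricted shuffles. Statement (ii) means that two restricted shuffles that differ as colored words have different underlying (uncolored) words. -}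

module Defs where

open import Data.Nat using (ℕ; zero; suc; _<_; _≟_)
open import Data.List using (List; []; _∷_; length; map)
open import Data.List.Relation.Unary.All using (All)
open import Data.Sum using (_⊎_; inj₁; inj₂; [_,_]′)
open import Data.Product using (_×_)
open import Data.Unit using (⊤)
open import Function using (id)
open import Relation.Nullary using (¬_; yes; no)
open import Relation.Binary.PropositionalEquality using (_≡_; _≢_)

-- A word is a list of natural numbers; words of the paper have positive letters.
Word : Set
Word = List ℕ

Positive : Word → Set
Positive = All (λ i → 0 < i)

swap : ℕ → ℕ → ℕ
swap i x with x ≟ i
... | yes _ = suc i
... | no _ with x ≟ suc i
...   | yes _ = i
...   | no _ = x

-- The permutation s_{i_1} ⋯ s_{i_l} represented by the word i_1 … i_l
-- (as a function: first apply s_{i_l}, …, last s_{i_1}).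
perm : Word → ℕ → ℕ
perm [] x = x
perm (i ∷ w) x = swap i (perm w x)

SamePerm : Word → Word → Set
SamePerm u v = ∀ x → perm u x ≡ perm v x

Reduced : Word → Set
Reduced w = ∀ (v : Word) → Positive v → length v < length w → ¬ SamePerm v w

-- Coloured words: inj₁ a = red letter a, inj₂ b = blue letter b.
CWord : Set
CWord = List (ℕ ⊎ ℕ)

reds : CWord → Word
reds [] = []
reds (inj₁ a ∷ w) = a ∷ reds w
reds (inj₂ b ∷ w) = reds w

blues : CWord → Word
blues [] = []
blues (inj₁ a ∷ w) = blues w
blues (inj₂ b ∷ w) = b ∷ blues w

erase : CWord → Word
erase = map [ id , id ]′

Far : ℕ → ℕ → Set
Far b r = (r ≢ b) × (suc r ≢ b) × (r ≢ suc b)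

-- Condition (2): for every blue letter b, every red letter to its right
-- (these are exactly α_i … α_n for the first red α_i to its right) is far from b.
RestrictedOK : CWord → Set
RestrictedOK [] = ⊤
RestrictedOK (inj₁ a ∷ w) = RestrictedOK w
RestrictedOK (inj₂ b ∷ w) = All (Far b) (reds w) × RestrictedOK w

IsResSh : Word → Word → CWord → Set
IsResSh α β w = (reds w ≡ α) × (blues w ≡ β) × RestrictedOK w

-- Condition (2) says that a blue letter commutes with every red letter to its
-- right, so moving all blue letters to the end turns a restricted shuffle w
-- into αβ by commutations only: erase w represents the same permutation as αβ
-- and has the same length, hence is reduced because αβ is. For (ii), at the
-- first position where two restricted shuffles differ in colour the same
-- letter b is blue in one and red in the other; both have the same red letters,
-- so in the first one that red b still lies to the right of the blue b,
-- contradicting condition (2).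
module Submission where

open import Defs
open import Data.List using (_++_; []; _∷_; length)
open import Data.List.Properties using (∷-injective; ∷-injectiveˡ; ∷-injectiveʳ; length-map; length-++-sucʳ)
open import Data.List.Relation.Unary.All using (All; []; _∷_)
open import Data.Product using (_×_; _,_)
open import Data.Sum using (_⊎_; inj₁; inj₂; [_,_]′)
open import Data.Nat using (suc; _≟_; _<_)
open import Data.Nat.Properties using (suc-injective; 1+n≢n)
open import Data.Empty using (⊥-elim)
open import Function using (id)
open import Relation.Nullary using (Dec; yes; no; ¬_)
open import Relation.Binary.PropositionalEquality
  using (_≡_; _≢_; refl; sym; trans; cong; subst; ≢-sym; module ≡-Reasoning)

open ≡-Reasoning

swap-self : ∀ i → swap i i ≡ suc i
swap-self i with i ≟ i
... | yes _ = refl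
... | no i≢i = ⊥-elim (i≢i refl)

swap-suc : ∀ i → swap i (suc i) ≡ i
swap-suc i with suc i ≟ i
... | yes 1+i≡i = ⊥-elim (1+n≢n 1+i≡i)
... | no _ with suc i ≟ suc i
...   | yes _ = refl
...   | no 1+i≢1+i = ⊥-elim (1+i≢1+i refl)

swap-fix : ∀ i {x} → x ≢ i → x ≢ suc i → swap i x ≡ x
swap-fix i {x} x≢i x≢1+i with x ≟ i
... | yes x≡i = ⊥-elim (x≢i x≡i)
... | no _ with x ≟ suc i
...   | yes x≡1+i = ⊥-elim (x≢1+i x≡1+i)
...   | no _ = refl

Far-sym : ∀ {b r} → Far b r → Far r b
Far-sym (r≢b , 1+r≢b , r≢1+b) = ≢-sym r≢b , ≢-sym r≢1+b , ≢-sym 1+r≢b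

Far-irrefl : ∀ {b} → ¬ Far b b
Far-irrefl (b≢b , _) = b≢b refl

swap-fix-far : ∀ {b r} → Far b r → swap b r ≡ r
swap-fix-far {b} (r≢b , _ , r≢1+b) = swap-fix b r≢b r≢1+b

swap-fix-far-suc : ∀ {b r} → Far b r → swap b (suc r) ≡ suc r
swap-fix-far-suc {b} (r≢b , 1+r≢b , _) = swap-fix b 1+r≢b (λ e → r≢b (suc-injective e))

swap-comm-on-support : ∀ {b r x} → Far b r → x ≡ r ⊎ x ≡ suc r →
                       swap b (swap r x) ≡ swap r (swap b x)
swap-comm-on-support {b} {r} far (inj₁ refl) = begin
  swap b (swap r r)   ≡⟨ cong (swap b) (swap-self r) ⟩
  swap b (suc r)      ≡⟨ swap-fix-far-suc far ⟩
  suc r               ≡⟨ sym (swap-self r) ⟩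
  swap r r            ≡⟨ cong (swap r) (sym (swap-fix-far far)) ⟩
  swap r (swap b r)   ∎
swap-comm-on-support {b} {r} far (inj₂ refl) = begin
  swap b (swap r (suc r))  ≡⟨ cong (swap b) (swap-suc r) ⟩
  swap b r                 ≡⟨ swap-fix-far far ⟩
  r                        ≡⟨ sym (swap-suc r) ⟩
  swap r (suc r)           ≡⟨ cong (swap r) (sym (swap-fix-far-suc far)) ⟩
  swap r (swap b (suc r))  ∎

swap-comm-far : ∀ {b r} x → Far b r → swap b (swap r x) ≡ swap r (swap b x)
swap-comm-far {b} {r} x far = by-cases (x ≟ r) (x ≟ suc r) (x ≟ b) (x ≟ suc b)
  where
  by-cases : Dec (x ≡ r) → Dec (x ≡ suc r) → Dec (x ≡ b) → Dec (x ≡ suc b) →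
             swap b (swap r x) ≡ swap r (swap b x)
  by-cases (yes x≡r) _ _ _ = swap-comm-on-support far (inj₁ x≡r)
  by-cases _ (yes x≡1+r) _ _ = swap-comm-on-support far (inj₂ x≡1+r)
  by-cases _ _ (yes x≡b) _ = sym (swap-comm-on-support (Far-sym far) (inj₁ x≡b))
  by-cases _ _ _ (yes x≡1+b) = sym (swap-comm-on-support (Far-sym far) (inj₂ x≡1+b))
  by-cases (no x≢r) (no x≢1+r) (no x≢b) (no x≢1+b) = begin
    swap b (swap r x)  ≡⟨ cong (swap b) (swap-fix r x≢r x≢1+r) ⟩
    swap b x           ≡⟨ swap-fix b x≢b x≢1+b ⟩
    x                  ≡⟨ sym (swap-fix r x≢r x≢1+r) ⟩
    swap r x           ≡⟨ cong (swap r) (sym (swap-fix b x≢b x≢1+b)) ⟩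
    swap r (swap b x)  ∎

perm-++ : ∀ (u v : Word) x → perm (u ++ v) x ≡ perm u (perm v x)
perm-++ []      v x = refl
perm-++ (i ∷ u) v x = cong (swap i) (perm-++ u v x)

swap-perm-comm-far : ∀ {b} (rs : Word) x → All (Far b) rs → swap b (perm rs x) ≡ perm rs (swap b x)
swap-perm-comm-far []       x []         = refl
swap-perm-comm-far (r ∷ rs) x (far ∷ fs) =
  trans (swap-comm-far (perm rs x) far) (cong (swap r) (swap-perm-comm-far rs x fs))

erase-samePerm : ∀ w → RestrictedOK w → SamePerm (erase w) (reds w ++ blues w)
erase-samePerm []           _  x = refl
erase-samePerm (inj₁ a ∷ w) ok x = cong (swap a) (erase-samePerm w ok x)
erase-samePerm (inj₂ b ∷ w) (fs , ok) x = begin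
  swap b (perm (erase w) x)                  ≡⟨ cong (swap b) (erase-samePerm w ok x) ⟩
  swap b (perm (reds w ++ blues w) x)        ≡⟨ cong (swap b) (perm-++ (reds w) (blues w) x) ⟩
  swap b (perm (reds w) (perm (blues w) x))  ≡⟨ swap-perm-comm-far (reds w) (perm (blues w) x) fs ⟩
  perm (reds w) (perm (b ∷ blues w) x)       ≡⟨ sym (perm-++ (reds w) (b ∷ blues w) x) ⟩
  perm (reds w ++ b ∷ blues w) x             ∎

length-erase : ∀ w → length (erase w) ≡ length (reds w ++ blues w)
length-erase w = trans (length-map [ id , id ]′ w) (length-reds-blues w)
  where
  length-reds-blues : ∀ w → length w ≡ length (reds w ++ blues w)
  length-reds-blues []           = refl
  length-reds-blues (inj₁ a ∷ w) = cong suc (length-reds-blues w)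
  length-reds-blues (inj₂ b ∷ w) =
    trans (cong suc (length-reds-blues w)) (sym (length-++-sucʳ (reds w) b (blues w)))

Reduced-resp : ∀ {w u} → SamePerm w u → length w ≡ length u → Reduced u → Reduced w
Reduced-resp w∼u |w|≡|u| reduced-u v pos-v |v|<|w| v∼w =
  reduced-u v pos-v (subst (length v <_) |w|≡|u| |v|<|w|) (λ x → trans (v∼w x) (w∼u x))

erase-injective : ∀ w w′ → RestrictedOK w → RestrictedOK w′ →
                  reds w ≡ reds w′ → blues w ≡ blues w′ → erase w ≡ erase w′ → w ≡ w′
erase-injective []           []            _ _ _ _ _ = refl
erase-injective (inj₁ a ∷ w) (inj₁ _ ∷ w′) ok ok′ rs bs es with ∷-injective es
... | refl , es′ = cong (inj₁ a ∷_) (erase-injective w w′ ok ok′ (∷-injectiveʳ rs) bs es′)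
erase-injective (inj₂ b ∷ w) (inj₂ _ ∷ w′) (_ , ok) (_ , ok′) rs bs es with ∷-injective es
... | refl , es′ = cong (inj₂ b ∷_) (erase-injective w w′ ok ok′ rs (∷-injectiveʳ bs) es′)
erase-injective (inj₁ a ∷ w) (inj₂ b ∷ w′) _ (fs , _) rs _ es with ∷-injectiveˡ es
... | refl with subst (All (Far a)) (sym rs) fs
...   | far ∷ _ = ⊥-elim (Far-irrefl far)
erase-injective (inj₂ b ∷ w) (inj₁ a ∷ w′) (fs , _) _ rs _ es with ∷-injectiveˡ es
... | refl with subst (All (Far b)) rs fs
...   | far ∷ _ = ⊥-elim (Far-irrefl far)

mainTheorem6 : (α β : Word) → Positive α → Positive β →
    Reduced α → Reduced β → Reduced (α ++ β) →
    ((w : CWord) → IsResSh α β w → Reduced (erase w))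
    × ((w w′ : CWord) → IsResSh α β w → IsResSh α β w′ → erase w ≡ erase w′ → w ≡ w′)
mainTheorem6 α β _ _ _ _ reduced-αβ = reduced , injective
  where
  reduced : (w : CWord) → IsResSh α β w → Reduced (erase w)
  reduced w (refl , refl , ok) = Reduced-resp {erase w} {reds w ++ blues w} (erase-samePerm w ok) (length-erase w) reduced-αβ

  injective : (w w′ : CWord) → IsResSh α β w → IsResSh α β w′ → erase w ≡ erase w′ → w ≡ w′
  injective w w′ (refl , refl , ok) (rs′ , bs′ , ok′) =
    erase-injective w w′ ok ok′ (sym rs′) (sym bs′)
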